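{- Let $A=\begin{pmatrix} a_1 & b_1\\ c_1 & d_1\end{pmatrix}$, $B=\begin{pmatrix} a_2 & b_2\\ c_2 & d_2\end{pmatrix}\in\mathrm{SL}_2(\mathbb{N}_0)$ be such that $(A,B)$ is a left-right pair. Then at least one of $c_1, c_2$ is nonzero.
   Context: $\mathbb{N}_0=\mathbb{N}\cup\{0\}$; $\mathrm{SL}_2(\mathbb{N}_0)$ is the set of $2\times2$ matrices with entries in $\mathbb{N}_0$ and determinant $1$, acting by the Möbius transformation $T(z)=\frac{az+b}{cz+d}$. With $\mathcal{D}_0=\{x+iy: x,y>0\}$, a pair $(A,B)$ of elements of $\mathrm{SL}_2(\mathbb{N}_0)$ is a left-right pair if $A(\mathcal{D}_0)\cap B(\mathcal{D}_0)=\emptyset$. -}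

module Defs where

open import Data.Nat as ℕ using (ℕ)
open import Data.Integer using (+_)
open import Data.Rational as ℚ using (ℚ; 0ℚ; _/_; 1/_; ≢-nonZero)
open import Data.Rational.Properties using (_≟_)
open import Data.Product using (Σ; _×_; _,_)
open import Relation.Binary.PropositionalEquality using (_≡_)
open import Relation.Nullary using (¬_; yes; no)

-- SL₂(ℕ₀): 2×2 matrices (a b ; c d) with entries in ℕ₀ and determinant 1,
-- i.e. a*d - b*c = 1, written without truncated subtraction as a*d = b*c + 1.
record SL2N0 : Set where
  constructor mat
  field
    a b c d : ℕ
    det : a ℕ.* d ≡ b ℕ.* c ℕ.+ 1
open SL2N0 public

record ℂℚ : Set where
  constructor _+i_
  field
    re im : ℚ
open ℂℚ public

fromℕ : ℕ → ℚ
fromℕ n = (+ n) / 1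

_⊕_ : ℂℚ → ℂℚ → ℂℚ
(x +i y) ⊕ (u +i v) = (x ℚ.+ u) +i (y ℚ.+ v)

_⊗_ : ℂℚ → ℂℚ → ℂℚ
(x +i y) ⊗ (u +i v) = ((x ℚ.* u) ℚ.- (y ℚ.* v)) +i ((x ℚ.* v) ℚ.+ (y ℚ.* u))

ofℕ : ℕ → ℂℚ
ofℕ n = fromℕ n +i 0ℚ

-- rational reciprocal, with the junk value 1/0 := 0
recipℚ : ℚ → ℚ
recipℚ q with q ≟ 0ℚ
... | yes _ = 0ℚ
... | no q≢0 = 1/_ q {{≢-nonZero q≢0}}

-- complex reciprocal 1/(u+iv) = (u - iv)/(u²+v²), junk value 0 at 0
inv : ℂℚ → ℂℚ
inv (u +i v) = (u ℚ.* r) +i (ℚ.- (v ℚ.* r))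
  where r = recipℚ ((u ℚ.* u) ℚ.+ (v ℚ.* v))

möbius : SL2N0 → ℂℚ → ℂℚ
möbius T z = ((ofℕ (a T) ⊗ z) ⊕ ofℕ (b T)) ⊗ inv ((ofℕ (c T) ⊗ z) ⊕ ofℕ (d T))

𝒟₀ : ℂℚ → Set
𝒟₀ z = (0ℚ ℚ.< re z) × (0ℚ ℚ.< im z)

InImage : SL2N0 → ℂℚ → Set
InImage T w = Σ ℂℚ (λ z → 𝒟₀ z × möbius T z ≡ w)

LeftRightPair : SL2N0 → SL2N0 → Set
LeftRightPair A B = (w : ℂℚ) → ¬ (InImage A w × InImage B w)

{-# OPTIONS --safe #-}
-- A matrix of SL₂(ℕ₀) with c = 0 has ad = 1, hence a = d = 1, so it acts as
-- the translation z ↦ z + b.  The images of 𝒟₀ under two translations by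
-- b₁, b₂ ≥ 0 always meet, e.g. in the point 1 + i + b₁ + b₂.
module Submission where

open import Defs
open import Data.Nat as ℕ using (ℕ; zero; suc)
import Data.Nat.Properties as ℕ
open import Data.Empty using (⊥; ⊥-elim)
open import Data.Product using (_×_; _,_)
open import Data.Sum using (_⊎_; inj₁; inj₂)
open import Data.Rational as ℚ using (0ℚ; 1ℚ)
open import Data.Rational.Properties
  using ( +-identityˡ; +-identityʳ; +-comm; +-assoc; *-identityˡ; *-identityʳ
        ; *-zeroˡ; *-zeroʳ; +-mono-<-≤; ≤-refl; positive⁻¹; nonNegative⁻¹; normalize-nonNeg)
open import Relation.Binary.PropositionalEquality
  using (_≡_; _≢_; refl; sym; trans; cong; cong₂; subst; module ≡-Reasoning)
open import Relation.Nullary using (¬_)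

0ℂ 1ℂ 1+i : ℂℚ
0ℂ  = 0ℚ +i 0ℚ
1ℂ  = 1ℚ +i 0ℚ
1+i = 1ℚ +i 1ℚ

fromℕ-nonNeg : (n : ℕ) → 0ℚ ℚ.≤ fromℕ n
fromℕ-nonNeg n = nonNegative⁻¹ (fromℕ n) {{normalize-nonNeg n 1}}

⊗-identityˡ : (z : ℂℚ) → 1ℂ ⊗ z ≡ z
⊗-identityˡ (x +i y) = cong₂ _+i_
  (trans (cong₂ ℚ._-_ (*-identityˡ x) (*-zeroˡ y)) (+-identityʳ x))
  (trans (cong₂ ℚ._+_ (*-identityˡ y) (*-zeroˡ x)) (+-identityʳ y))

⊗-identityʳ : (z : ℂℚ) → z ⊗ 1ℂ ≡ z
⊗-identityʳ (x +i y) = cong₂ _+i_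
  (trans (cong₂ ℚ._-_ (*-identityʳ x) (*-zeroʳ y)) (+-identityʳ x))
  (trans (cong₂ ℚ._+_ (*-zeroʳ x) (*-identityʳ y)) (+-identityˡ y))

⊗-zeroˡ : (z : ℂℚ) → 0ℂ ⊗ z ≡ 0ℂ
⊗-zeroˡ (x +i y) = cong₂ _+i_
  (cong₂ ℚ._-_ (*-zeroˡ x) (*-zeroˡ y))
  (cong₂ ℚ._+_ (*-zeroˡ y) (*-zeroˡ x))

⊕-comm : (z w : ℂℚ) → z ⊕ w ≡ w ⊕ z
⊕-comm (x +i y) (u +i v) = cong₂ _+i_ (+-comm x u) (+-comm y v)

⊕-assoc : (z w v : ℂℚ) → (z ⊕ w) ⊕ v ≡ z ⊕ (w ⊕ v)
⊕-assoc (x +i y) (u +i v) (s +i t) = cong₂ _+i_ (+-assoc x u s) (+-assoc y v t)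

⊕-exchangeʳ : (z w v : ℂℚ) → (z ⊕ w) ⊕ v ≡ (z ⊕ v) ⊕ w
⊕-exchangeʳ z w v = begin
  (z ⊕ w) ⊕ v  ≡⟨ ⊕-assoc z w v ⟩
  z ⊕ (w ⊕ v)  ≡⟨ cong (z ⊕_) (⊕-comm w v) ⟩
  z ⊕ (v ⊕ w)  ≡⟨ sym (⊕-assoc z v w) ⟩
  (z ⊕ v) ⊕ w  ∎
  where open ≡-Reasoning

𝒟₀-⊕-ofℕ : {z : ℂℚ} (n : ℕ) → 𝒟₀ z → 𝒟₀ (z ⊕ ofℕ n)
𝒟₀-⊕-ofℕ n (0<x , 0<y) = +-mono-<-≤ 0<x (fromℕ-nonNeg n) , +-mono-<-≤ 0<y ≤-refl

1+i∈𝒟₀ : 𝒟₀ 1+i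
1+i∈𝒟₀ = positive⁻¹ 1ℚ , positive⁻¹ 1ℚ

möbius-translation : (b : ℕ) (det : 1 ℕ.* 1 ≡ b ℕ.* 0 ℕ.+ 1) (z : ℂℚ) →
                     möbius (mat 1 b 0 1 det) z ≡ z ⊕ ofℕ b
möbius-translation b _ z = begin
  ((1ℂ ⊗ z) ⊕ ofℕ b) ⊗ inv ((0ℂ ⊗ z) ⊕ 1ℂ)
    ≡⟨ cong₂ (λ u v → (u ⊕ ofℕ b) ⊗ inv (v ⊕ 1ℂ)) (⊗-identityˡ z) (⊗-zeroˡ z) ⟩
  -- inv (0ℂ ⊕ 1ℂ) is a closed term and normalises to 1ℂ
  (z ⊕ ofℕ b) ⊗ 1ℂ
    ≡⟨ ⊗-identityʳ (z ⊕ ofℕ b) ⟩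
  z ⊕ ofℕ b ∎
  where open ≡-Reasoning

c≡0⇒a≡1×d≡1 : (T : SL2N0) → c T ≡ 0 → a T ≡ 1 × d T ≡ 1
c≡0⇒a≡1×d≡1 (mat a b .0 d det) refl = ℕ.m*n≡1⇒m≡1 a d ad≡1 , ℕ.m*n≡1⇒n≡1 a d ad≡1
  where
  ad≡1 : a ℕ.* d ≡ 1
  ad≡1 = trans det (cong (ℕ._+ 1) (ℕ.*-zeroʳ b))

c≡0⇒möbius≡translation : (T : SL2N0) → c T ≡ 0 → (z : ℂℚ) → möbius T z ≡ z ⊕ ofℕ (b T)
c≡0⇒möbius≡translation T@(mat _ b .0 _ det) refl with c≡0⇒a≡1×d≡1 T refl
... | refl , refl = möbius-translation b det

translate-∈-image : (T : SL2N0) → c T ≡ 0 → {z : ℂℚ} → 𝒟₀ z → InImage T (z ⊕ ofℕ (b T))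
translate-∈-image T c≡0 {z} z∈𝒟₀ = z , z∈𝒟₀ , c≡0⇒möbius≡translation T c≡0 z

translations-not-left-right : (A B : SL2N0) → c A ≡ 0 → c B ≡ 0 → ¬ LeftRightPair A B
translations-not-left-right A B cA≡0 cB≡0 lr = lr w (w∈A𝒟₀ , w∈B𝒟₀)
  where
  w : ℂℚ
  w = (1+i ⊕ ofℕ (b B)) ⊕ ofℕ (b A)
  w∈A𝒟₀ : InImage A w
  w∈A𝒟₀ = translate-∈-image A cA≡0 (𝒟₀-⊕-ofℕ (b B) 1+i∈𝒟₀)
  w∈B𝒟₀ : InImage B w
  w∈B𝒟₀ = subst (InImage B) (⊕-exchangeʳ 1+i (ofℕ (b A)) (ofℕ (b B)))
                (translate-∈-image B cB≡0 (𝒟₀-⊕-ofℕ (b A) 1+i∈𝒟₀))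

≢0⊎≢0 : (m n : ℕ) → (m ≡ 0 → n ≡ 0 → ⊥) → m ≢ 0 ⊎ n ≢ 0
≢0⊎≢0 (suc _) _       _     = inj₁ λ ()
≢0⊎≢0 zero    (suc _) _     = inj₂ λ ()
≢0⊎≢0 zero    zero    ¬both = ⊥-elim (¬both refl refl)

lemma3p5 : (A B : SL2N0) → LeftRightPair A B → (c A ≢ 0) ⊎ (c B ≢ 0)
lemma3p5 A B lr = ≢0⊎≢0 (c A) (c B) λ cA≡0 cB≡0 → translations-not-left-right A B cA≡0 cB≡0 lr
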